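{- Let $P_n$ be the path on $n \ge 4$ vertices and let $\emptyset \neq Q \subseteq V(P_n)$. If there is more than one maximal absolute $c_Q$-visible set of $P_n$, then these sets are pairwise disjoint.
   Context: For a graph $G$ and $X \subseteq V(G)$, two vertices $u,v$ are $X$-visible if there exists a shortest $(u,v)$-path $P$ in $G$ with $V(P)\cap X \subseteq \{u,v\}$; a set $Y$ is $X$-visible if every two vertices of $Y$ are $X$-visible. A set $X\subseteq V(G)$ is a mutual-visibility set of $G$ if it is $X$-visible. For $Q\subseteq V(G)$, a set $W\subseteq \overline{Q}=V(G)\setminus Q$ is $c_Q$-visible if $W$ is $Q$-visible and $u,w$ are $Q$-visible for all $u\in Q$, $w\in W$; it is an absolute $c_Q$-visible set if moreover $Q$ is a mutual-visibility set of $G$. An absolute $c_Q$-visible set is maximal if it is not a proper subset of any other absolute $c_Q$-visible set. -}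

module Defs where

open import Data.Nat using (ℕ; suc; _≤_)
open import Data.Fin using (Fin; toℕ)
open import Data.Fin.Subset using (Subset; _∈_; _∉_; _⊆_; _⊂_; ∁)
open import Data.List using (List; []; _∷_)
open import Data.List.Relation.Unary.Unique.Propositional using (Unique)
import Data.List.Membership.Propositional as LM
open import Data.Product using (Σ; ∃; _×_)
open import Data.Sum using (_⊎_)
open import Relation.Nullary using (¬_)
open import Relation.Binary.PropositionalEquality using (_≡_)

record Graph (n : ℕ) : Set₁ where
  field
    Adj : Fin n → Fin n → Set

PathGraph : (n : ℕ) → Graph n
PathGraph n = record { Adj = λ i j → (toℕ j ≡ suc (toℕ i)) ⊎ (toℕ i ≡ suc (toℕ j)) }

module _ {n : ℕ} (G : Graph n) where
  open Graph G

  data Walk : Fin n → Fin n → Set where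
    [_]  : (u : Fin n) → Walk u u
    step : (u : Fin n) {w v : Fin n} → Adj u w → Walk w v → Walk u v

  len : ∀ {u v} → Walk u v → ℕ
  len [ u ] = 0
  len (step u _ p) = suc (len p)

  verts : ∀ {u v} → Walk u v → List (Fin n)
  verts [ u ] = u ∷ []
  verts (step u _ p) = u ∷ verts p

  IsPath : ∀ {u v} → Walk u v → Set
  IsPath p = Unique (verts p)

  IsShortestPath : ∀ {u v} → Walk u v → Set
  IsShortestPath {u} {v} p = IsPath p × (∀ (q : Walk u v) → IsPath q → len p ≤ len q)

  Visible : Subset n → Fin n → Fin n → Set
  Visible X u v = Σ (Walk u v) λ p → IsShortestPath p ×
    (∀ x → x LM.∈ verts p → x ∈ X → (x ≡ u) ⊎ (x ≡ v))

  VisibleSet : Subset n → Subset n → Set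
  VisibleSet X Y = ∀ u v → u ∈ Y → v ∈ Y → Visible X u v

  MutualVisibilitySet : Subset n → Set
  MutualVisibilitySet X = VisibleSet X X

  CVisible : Subset n → Subset n → Set
  CVisible Q W = (W ⊆ ∁ Q) × VisibleSet Q W × (∀ u w → u ∈ Q → w ∈ W → Visible Q u w)

  AbsCVisible : Subset n → Subset n → Set
  AbsCVisible Q W = CVisible Q W × MutualVisibilitySet Q

  MaximalAbsCVisible : Subset n → Subset n → Set
  MaximalAbsCVisible Q W = AbsCVisible Q W × (∀ W′ → AbsCVisible Q W′ → ¬ (W ⊂ W′))

-- In a path, u and v are Q-visible exactly when no vertex of Q lies strictly
-- between them: every (u,v)-walk passes through all vertices between u and v,
-- and the monotone path passes through nothing else. Hence visibility composes
-- through any vertex outside Q. Two absolute c_Q-visible sets sharing a vertex x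
-- (which lies outside Q) therefore have an absolute c_Q-visible union, and
-- maximality forces both sets to equal it.
{-# OPTIONS --safe #-}
module Submission where

open import Defs
open import Data.Nat using (ℕ; zero; suc; _+_; _≤_; _<_; ∣_-_∣; z≤n; s≤s; s≤s⁻¹)
open import Data.Nat.Properties
open import Data.Fin using (Fin; toℕ; fromℕ<) renaming (_≟_ to _≟ᶠ_)
open import Data.Fin.Properties using (toℕ-injective; toℕ-fromℕ<; toℕ<n)
open import Data.Fin.Subset using (Subset; _∈_; _∉_; _⊆_; _∪_; Nonempty)
open import Data.Fin.Subset.Properties using (⊆-antisym; x∈p∪q⁻; p⊆p∪q; q⊆p∪q; x∈∁p⇒x∉p; _∈?_)
open import Data.Product using (Σ; ∃; ∃₂; _×_; _,_; proj₁)
open import Data.Sum using (_⊎_; inj₁; inj₂; [_,_]′)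
open import Data.Empty using (⊥; ⊥-elim)
open import Data.List.Relation.Unary.Any using (here; there)
open import Data.List.Relation.Unary.All using (tabulate; [])
open import Data.List.Relation.Unary.AllPairs using ([]; _∷_)
import Data.List.Membership.Propositional as List
open import Relation.Nullary using (yes; no)
open import Function using (_∘_)
open import Relation.Binary.PropositionalEquality using (_≡_; _≢_; refl; sym; cong; subst)

module _ {n : ℕ} {G : Graph n} {Q : Subset n} where

  VisibilityComposes : Set
  VisibilityComposes = ∀ {u x v} → x ∉ Q → Visible G Q u x → Visible G Q x v → Visible G Q u v

  maximal⇒⊆-maximal : ∀ {W W′} → MaximalAbsCVisible G Q W → AbsCVisible G Q W′ → W ⊆ W′ → W′ ⊆ W
  maximal⇒⊆-maximal {W} (_ , maximal) W′-abs W⊆W′ {y} y∈W′ with y ∈? W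
  ... | yes y∈W = y∈W
  ... | no  y∉W = ⊥-elim (maximal _ W′-abs (W⊆W′ , y , y∈W′ , y∉W))

  ∪-absCVisible : VisibilityComposes → ∀ {W W′ x} → x ∈ W → x ∈ W′ →
                  AbsCVisible G Q W → AbsCVisible G Q W′ → AbsCVisible G Q (W ∪ W′)
  ∪-absCVisible compose {W} {W′} {x} x∈W x∈W′
    ((W⊆∁Q , W-visible , QW-visible) , Q-mutual) ((W′⊆∁Q , W′-visible , QW′-visible) , _) =
    ([ W⊆∁Q , W′⊆∁Q ]′ ∘ x∈p∪q⁻ W W′ , ∪-visible , Q∪-visible) , Q-mutual
    where
    x∉Q : x ∉ Q
    x∉Q = x∈∁p⇒x∉p (W⊆∁Q x∈W)

    ∪-visible : VisibleSet G Q (W ∪ W′)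
    ∪-visible u v u∈ v∈ with x∈p∪q⁻ W W′ u∈ | x∈p∪q⁻ W W′ v∈
    ... | inj₁ u∈W  | inj₁ v∈W  = W-visible u v u∈W v∈W
    ... | inj₁ u∈W  | inj₂ v∈W′ = compose x∉Q (W-visible u x u∈W x∈W) (W′-visible x v x∈W′ v∈W′)
    ... | inj₂ u∈W′ | inj₁ v∈W  = compose x∉Q (W′-visible u x u∈W′ x∈W′) (W-visible x v x∈W v∈W)
    ... | inj₂ u∈W′ | inj₂ v∈W′ = W′-visible u v u∈W′ v∈W′

    Q∪-visible : ∀ u w → u ∈ Q → w ∈ W ∪ W′ → Visible G Q u w
    Q∪-visible u w u∈Q = [ QW-visible u w u∈Q , QW′-visible u w u∈Q ]′ ∘ x∈p∪q⁻ W W′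

  meeting-maximalAbsCVisible-≡ : VisibilityComposes → ∀ {W W′ x} →
                                 MaximalAbsCVisible G Q W → MaximalAbsCVisible G Q W′ → x ∈ W → x ∈ W′ → W ≡ W′
  meeting-maximalAbsCVisible-≡ compose {W} {W′} W-max W′-max x∈W x∈W′ = ⊆-antisym W⊆W′ W′⊆W
    where
    W∪W′-abs : AbsCVisible G Q (W ∪ W′)
    W∪W′-abs = ∪-absCVisible compose x∈W x∈W′ (proj₁ W-max) (proj₁ W′-max)

    W⊆W′ : W ⊆ W′
    W⊆W′ = maximal⇒⊆-maximal W′-max W∪W′-abs (q⊆p∪q W W′) ∘ p⊆p∪q W′

    W′⊆W : W′ ⊆ W
    W′⊆W = maximal⇒⊆-maximal W-max W∪W′-abs (p⊆p∪q W′) ∘ q⊆p∪q W W′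

Between : ℕ → ℕ → ℕ → Set
Between a y c = (a ≤ y × y ≤ c) ⊎ (c ≤ y × y ≤ a)

between-left : ∀ a c → Between a a c
between-left a c with ≤-total a c
... | inj₁ a≤c = inj₁ (≤-refl , a≤c)
... | inj₂ c≤a = inj₂ (c≤a , ≤-refl)

between-self : ∀ {a y} → Between a y a → y ≡ a
between-self (inj₁ (a≤y , y≤a)) = ≤-antisym y≤a a≤y
between-self (inj₂ (a≤y , y≤a)) = ≤-antisym y≤a a≤y

between-antisym : ∀ {a b c} → Between a b c → Between b a c → a ≡ b
between-antisym (inj₁ (a≤b , _))   (inj₁ (b≤a , _))   = ≤-antisym a≤b b≤a
between-antisym (inj₁ (a≤b , b≤c)) (inj₂ (c≤a , _))   = ≤-antisym a≤b (≤-trans b≤c c≤a)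
between-antisym (inj₂ (c≤b , b≤a)) (inj₁ (_ , a≤c))   = ≤-antisym (≤-trans a≤c c≤b) b≤a
between-antisym (inj₂ (_ , b≤a))   (inj₂ (_ , a≤b))   = ≤-antisym a≤b b≤a

between-shrink : ∀ {a b c y} → Between a b c → Between b y c → Between a y c
between-shrink (inj₁ (a≤b , _))   (inj₁ (b≤y , y≤c)) = inj₁ (≤-trans a≤b b≤y , y≤c)
between-shrink (inj₁ (a≤b , b≤c)) (inj₂ (c≤y , y≤b)) = inj₁ (≤-trans a≤b (≤-trans b≤c c≤y) , ≤-trans y≤b b≤c)
between-shrink (inj₂ (c≤b , b≤a)) (inj₁ (b≤y , y≤c)) = inj₂ (≤-trans c≤b b≤y , ≤-trans y≤c (≤-trans c≤b b≤a))
between-shrink (inj₂ (_ , b≤a))   (inj₂ (c≤y , y≤b)) = inj₂ (c≤y , ≤-trans y≤b b≤a)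

between-split : ∀ {a y c} → Between a y c → ∀ b → Between a y b ⊎ Between b y c
between-split {y = y} (inj₁ (a≤y , y≤c)) b with ≤-total b y
... | inj₁ b≤y = inj₂ (inj₁ (b≤y , y≤c))
... | inj₂ y≤b = inj₁ (inj₁ (a≤y , y≤b))
between-split {y = y} (inj₂ (c≤y , y≤a)) b with ≤-total b y
... | inj₁ b≤y = inj₁ (inj₂ (b≤y , y≤a))
... | inj₂ y≤b = inj₂ (inj₂ (c≤y , y≤b))

between-< : ∀ {a y c n} → Between a y c → a < n → c < n → y < n
between-< (inj₁ (_ , y≤c)) _   c<n = ≤-<-trans y≤c c<n
between-< (inj₂ (_ , y≤a)) a<n _   = ≤-<-trans y≤a a<n

-- Graph.Adj (PathGraph n) u w unfolds to Adjacent (toℕ u) (toℕ w).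
Adjacent : ℕ → ℕ → Set
Adjacent a b = (b ≡ suc a) ⊎ (a ≡ suc b)

adjacent⇒≢ : ∀ {a b} → Adjacent a b → a ≢ b
adjacent⇒≢ (inj₁ a≡1+a) refl = 1+n≢n (sym a≡1+a)
adjacent⇒≢ (inj₂ a≡1+a) refl = 1+n≢n (sym a≡1+a)

∣n-1+n∣≡1 : ∀ n → ∣ n - suc n ∣ ≡ 1
∣n-1+n∣≡1 zero    = refl
∣n-1+n∣≡1 (suc n) = ∣n-1+n∣≡1 n

adjacent⇒∣-∣≡1 : ∀ {a b} → Adjacent a b → ∣ a - b ∣ ≡ 1
adjacent⇒∣-∣≡1 {a} (inj₁ refl) = ∣n-1+n∣≡1 a
adjacent⇒∣-∣≡1 {b = b} (inj₂ refl) = subst (_≡ 1) (∣-∣-comm b (suc b)) (∣n-1+n∣≡1 b)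

between-adjacent : ∀ {a b c y} → Adjacent a b → Between a y c → y ≢ a → Between b y c
between-adjacent (inj₁ refl) (inj₁ (a≤y , y≤c)) y≢a = inj₁ (≤∧≢⇒< a≤y (y≢a ∘ sym) , y≤c)
between-adjacent {a} (inj₁ refl) (inj₂ (c≤y , y≤a)) _ = inj₂ (c≤y , ≤-trans y≤a (n≤1+n a))
between-adjacent {b = b} (inj₂ refl) (inj₁ (a≤y , y≤c)) _ = inj₁ (≤-trans (n≤1+n b) a≤y , y≤c)
between-adjacent (inj₂ refl) (inj₂ (c≤y , y≤a)) y≢a = inj₂ (c≤y , s≤s⁻¹ (≤∧≢⇒< y≤a y≢a))

adjacent-suc : ∀ {a b} → Adjacent a b → Adjacent (suc a) (suc b)
adjacent-suc (inj₁ e) = inj₁ (cong suc e)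
adjacent-suc (inj₂ e) = inj₂ (cong suc e)

between-suc : ∀ {a b c} → Between a b c → Between (suc a) (suc b) (suc c)
between-suc (inj₁ (a≤b , b≤c)) = inj₁ (s≤s a≤b , s≤s b≤c)
between-suc (inj₂ (c≤b , b≤a)) = inj₂ (s≤s c≤b , s≤s b≤a)

step-toward : ∀ {a c k} → ∣ a - c ∣ ≡ suc k → ∃ λ b → Adjacent a b × ∣ b - c ∣ ≡ k × Between a b c
step-toward {zero}  {suc c} refl = 1 , inj₁ refl , refl , inj₁ (z≤n , s≤s z≤n)
step-toward {suc a} {zero}  refl = a , inj₂ refl , ∣-∣-identityʳ a , inj₂ (z≤n , n≤1+n a)
step-toward {suc a} {suc c} d with step-toward {a} {c} d
... | b , a~b , d′ , a≤b≤c = suc b , adjacent-suc a~b , d′ , between-suc a≤b≤c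

module _ {n : ℕ} where
  private
    P : Graph n
    P = PathGraph n

  ∣-∣≤len : ∀ {u v} (p : Walk P u v) → ∣ toℕ u - toℕ v ∣ ≤ len P p
  ∣-∣≤len [ u ] = ≤-reflexive (∣n-n∣≡0 (toℕ u))
  ∣-∣≤len {v = v} (step u {w} u~w p) = begin
    ∣ toℕ u - toℕ v ∣                    ≤⟨ ∣-∣-triangle (toℕ u) (toℕ w) (toℕ v) ⟩
    ∣ toℕ u - toℕ w ∣ + ∣ toℕ w - toℕ v ∣ ≡⟨ cong (_+ ∣ toℕ w - toℕ v ∣) (adjacent⇒∣-∣≡1 u~w) ⟩
    suc ∣ toℕ w - toℕ v ∣                ≤⟨ s≤s (∣-∣≤len p) ⟩
    suc (len P p)                        ∎
    where open ≤-Reasoning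

  between⇒∈verts : ∀ {u v y} (p : Walk P u v) → Between (toℕ u) (toℕ y) (toℕ v) → y List.∈ verts P p
  between⇒∈verts [ u ] u≤y≤u = here (toℕ-injective (between-self u≤y≤u))
  between⇒∈verts {y = y} (step u u~w p) u≤y≤v with y ≟ᶠ u
  ... | yes y≡u = here y≡u
  ... | no  y≢u = there (between⇒∈verts p (between-adjacent u~w u≤y≤v (y≢u ∘ toℕ-injective)))

  neighbour-toward : ∀ {u v : Fin n} {k} → ∣ toℕ u - toℕ v ∣ ≡ suc k →
                     ∃ λ w → Graph.Adj P u w × ∣ toℕ w - toℕ v ∣ ≡ k × Between (toℕ u) (toℕ w) (toℕ v)
  neighbour-toward {u} {v} {k} d with step-toward d
  ... | c , facts@(_ , _ , u≤c≤v) = fromℕ< c<n , subst NeighbourToward (sym (toℕ-fromℕ< c<n)) facts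
    where
    c<n : c < n
    c<n = between-< u≤c≤v (toℕ<n u) (toℕ<n v)
    NeighbourToward : ℕ → Set
    NeighbourToward c = Adjacent (toℕ u) c × ∣ c - toℕ v ∣ ≡ k × Between (toℕ u) c (toℕ v)

  geodesic : ∀ k {u v} → ∣ toℕ u - toℕ v ∣ ≡ k →
             Σ (Walk P u v) λ p → len P p ≡ k × IsPath P p ×
               (∀ y → y List.∈ verts P p → Between (toℕ u) (toℕ y) (toℕ v))
  geodesic zero {u} {v} d with toℕ-injective {i = u} {j = v} (∣m-n∣≡0⇒m≡n d)
  ... | refl = [ u ] , refl , [] ∷ [] , λ { _ (here refl) → between-left (toℕ u) (toℕ u) }
  geodesic (suc k) {u} {v} d with neighbour-toward d
  ... | w , u~w , d′ , u≤w≤v with geodesic k d′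
  ... | p , len≡k , p-path , p-between = step u u~w p , cong suc len≡k , tabulate u∉p ∷ p-path , between
    where
    u∉p : ∀ {y} → y List.∈ verts P p → u ≢ y
    u∉p y∈p refl = adjacent⇒≢ u~w (between-antisym u≤w≤v (p-between u y∈p))
    between : ∀ y → y List.∈ verts P (step u u~w p) → Between (toℕ u) (toℕ y) (toℕ v)
    between _ (here refl) = between-left (toℕ u) (toℕ v)
    between y (there y∈p) = between-shrink u≤w≤v (p-between y y∈p)

  Unobstructed : Subset n → Fin n → Fin n → Set
  Unobstructed Q u v = ∀ y → y ∈ Q → Between (toℕ u) (toℕ y) (toℕ v) → y ≡ u ⊎ y ≡ v

  visible⇒unobstructed : ∀ {Q u v} → Visible P Q u v → Unobstructed Q u v
  visible⇒unobstructed (p , _ , avoids) y y∈Q u≤y≤v = avoids y (between⇒∈verts p u≤y≤v) y∈Q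

  unobstructed⇒visible : ∀ {Q u v} → Unobstructed Q u v → Visible P Q u v
  unobstructed⇒visible clear with geodesic _ refl
  ... | p , len≡ , p-path , p-between =
    p , (p-path , λ q _ → subst (_≤ len P q) (sym len≡) (∣-∣≤len q)) , λ y y∈p y∈Q → clear y y∈Q (p-between y y∈p)

  unobstructed-trans : ∀ {Q u x v} → x ∉ Q → Unobstructed Q u x → Unobstructed Q x v → Unobstructed Q u v
  unobstructed-trans {x = x} x∉Q clear₁ clear₂ y y∈Q u≤y≤v with between-split u≤y≤v (toℕ x)
  ... | inj₁ u≤y≤x = [ inj₁ , (λ { refl → ⊥-elim (x∉Q y∈Q) }) ]′ (clear₁ y y∈Q u≤y≤x)
  ... | inj₂ x≤y≤v = [ (λ { refl → ⊥-elim (x∉Q y∈Q) }) , inj₂ ]′ (clear₂ y y∈Q x≤y≤v)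

  pathGraph-visibilityComposes : ∀ {Q} → VisibilityComposes {G = P} {Q}
  pathGraph-visibilityComposes x∉Q ux xv =
    unobstructed⇒visible (unobstructed-trans x∉Q (visible⇒unobstructed ux) (visible⇒unobstructed xv))

mainTheorem15 : (n : ℕ) → 4 ≤ n → (Q : Subset n) → Nonempty Q →
    (∃₂ λ W₁ W₂ → MaximalAbsCVisible (PathGraph n) Q W₁ × MaximalAbsCVisible (PathGraph n) Q W₂ × W₁ ≢ W₂) →
    ∀ (W W′ : Subset n) → MaximalAbsCVisible (PathGraph n) Q W → MaximalAbsCVisible (PathGraph n) Q W′ → W ≢ W′ →
    ∀ (x : Fin n) → x ∈ W → x ∈ W′ → ⊥
mainTheorem15 n _ Q _ _ W W′ W-max W′-max W≢W′ x x∈W x∈W′ =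
  W≢W′ (meeting-maximalAbsCVisible-≡ pathGraph-visibilityComposes W-max W′-max x∈W x∈W′)
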